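{- For any base $b\ge2$, $$K(3)=\begin{cases}129,& b=2,\\ 28,& b=3,\\ b^{b+3}+1,& b\ge4 \text{ even},\\ b^2+1,& b\ge5\text{ odd},\end{cases}\qquad B(3)=\begin{cases}7,& b=2,\\ 3,& b=3,\\ b+3,& b\ge4\text{ even},\\ 2,& b\ge5\text{ odd},\end{cases}$$ where $B(3)=\lfloor\log_b K(3)\rfloor$.
   Context: Fix a base $b\ge2$. For $v\in\mathbb{N}$, $s(v)$ is the sum of the base-$b$ digits of $v$, $f(v)=v+s(v)$, and $F(u)=|\{v\in\mathbb{N}: f(v)=u\}|$. For $n\ge1$, $K(n)$ denotes the smallest $u\in\mathbb{N}$ with $F(u)=n$. -}

module Defs where

open import Data.Nat using (ℕ; zero; suc; _+_; _*_; _^_; _≤_; _<_; _≡ᵇ_; NonZero)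
open import Data.Nat.DivMod using (_/_; _%_)
open import Data.List using (List; length; filter; upTo)
open import Data.Bool using (T)
open import Relation.Nullary.Decidable using (T?)
open import Relation.Binary.PropositionalEquality using (_≡_)
open import Data.Product using (_×_)
open import Relation.Nullary using (¬_)

-- sum of base-b digits of v, computed with fuel; fuel v suffices since
-- the number of base-b digits of v (b ≥ 2) is at most v.
digitSumFuel : (b : ℕ) .{{_ : NonZero b}} → ℕ → ℕ → ℕ
digitSumFuel b zero    v = 0
digitSumFuel b (suc k) v = v % b + digitSumFuel b k (v / b)

s : (b : ℕ) .{{_ : NonZero b}} → ℕ → ℕ
s b v = digitSumFuel b v v

f : (b : ℕ) .{{_ : NonZero b}} → ℕ → ℕ
f b v = v + s b v

-- F(u) = #{ v ∈ ℕ : f(v) = u }; since f(v) ≥ v, every such v lies in [0, u].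
F : (b : ℕ) .{{_ : NonZero b}} → ℕ → ℕ
F b u = length (filter (λ v → T? (f b v ≡ᵇ u)) (upTo (suc u)))

IsK : (b : ℕ) .{{_ : NonZero b}} → ℕ → ℕ → Set
IsK b n K = (F b K ≡ n) × (∀ u → u < K → ¬ (F b u ≡ n))

IsFloorLog : ℕ → ℕ → ℕ → Set
IsFloorLog b x B = (b ^ B ≤ x) × (x < b ^ suc B)

-- With T(v) = Σ_{i≥1} ⌊v / b^i⌋ one has s(v) + (b − 1) T(v) = v, so f(v) = f(v + d) means
-- (b − 1)(T(v + d) − T(v)) = 2d. If b − 1 is odd this forces d = (b − 1) m and
-- T(v + d) = T(v) + 2m. Since T(x + y) exceeds T(x) + T(y) only by the number of carries,
-- m ≤ b + 1 below b^(b+3), and tracking the two lowest carries shows that a given v has at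
-- most one such offset m; hence no three numbers below b^(b+3) share an f-value. For odd b
-- the same holds below b² by a direct two-digit computation. In either case f(b^k) = b^k + 1
-- and two explicit numbers below b^k also map to b^k + 1, so K(3) = b^k + 1; bases 2 and 3
-- are settled by evaluation.

module Submission where

open import Defs
open import Data.Nat
open import Data.Nat.Properties
open import Data.Nat.DivMod
open import Data.Nat.Divisibility using (_∣_; divides; ∣-refl; ∣m∣n⇒∣m+n; ∣m+n∣m⇒∣n; ∣1⇒≡1)
open import Data.Nat.Induction using (<-rec)
open import Data.Nat.Tactic.RingSolver using (solve-∀)
open import Relation.Binary.Definitions using (tri<; tri≈; tri>)
open import Relation.Binary.PropositionalEquality using (_≡_; _≢_; refl; sym; trans; cong; cong₂; subst; module ≡-Reasoning)
open import Data.Product using (∃-syntax; _×_; _,_)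
open import Data.Sum using (inj₁; inj₂)
open import Data.Empty using (⊥; ⊥-elim)
open import Data.Bool using (Bool; true; false; if_then_else_; T)
open import Data.List using (length; filter; upTo; _++_; [_])
open import Data.List.Properties using (upTo-∷ʳ; filter-++; length-++)
open import Relation.Nullary.Decidable using (T?; does; dec-true; dec-false; toWitness; ¬?)
open import Function using (_∘_)
open import Relation.Nullary using (¬_; contradiction)
open import Data.Nat.Primality using (prime[2]; euclidsLemma)

n+n≡n*2 : ∀ n → n + n ≡ n * 2
n+n≡n*2 = solve-∀

m+m≡n+n⇒m≡n : ∀ {m n} → m + m ≡ n + n → m ≡ n
m+m≡n+n⇒m≡n {m} {n} eq = *-cancelʳ-≡ m n 2 (trans (sym (n+n≡n*2 m)) (trans eq (n+n≡n*2 n)))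

¬2∣⇒odd : ∀ n → ¬ 2 ∣ n → ∃[ h ] n ≡ suc (h + h)
¬2∣⇒odd zero          ¬2∣n = contradiction (divides 0 refl) ¬2∣n
¬2∣⇒odd (suc zero)    _    = 0 , refl
¬2∣⇒odd (suc (suc n)) ¬2∣n with ¬2∣⇒odd n (¬2∣n ∘ ∣m∣n⇒∣m+n ∣-refl)
... | h , refl = suc h , cong (suc ∘ suc) (sym (+-suc h h))

2∣1+n⇒¬2∣n : ∀ {n} → 2 ∣ suc n → ¬ 2 ∣ n
2∣1+n⇒¬2∣n {n} 2∣1+n 2∣n with ∣1⇒≡1 (∣m+n∣m⇒∣n (subst (2 ∣_) (+-comm 1 n) 2∣1+n) 2∣n)
... | ()

count : (ℕ → Bool) → ℕ → ℕ
count g zero    = 0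
count g (suc n) = count g n + (if g n then 1 else 0)

module _ (g : ℕ → Bool) where

  length-filter-upTo : ∀ n → length (filter (λ v → T? (g v)) (upTo n)) ≡ count g n
  length-filter-upTo zero    = refl
  length-filter-upTo (suc n) = begin
    length (filter P (upTo (suc n)))                     ≡⟨ cong (length ∘ filter P) (upTo-∷ʳ n) ⟨
    length (filter P (upTo n ++ [ n ]))                  ≡⟨ cong length (filter-++ P (upTo n) [ n ]) ⟩
    length (filter P (upTo n) ++ filter P [ n ])         ≡⟨ length-++ (filter P (upTo n)) ⟩
    length (filter P (upTo n)) + length (filter P [ n ]) ≡⟨ cong₂ _+_ (length-filter-upTo n) singleton ⟩
    count g (suc n)                                      ∎
    where
    open ≡-Reasoning
    P = λ v → T? (g v)
    singleton : length (filter P [ n ]) ≡ (if g n then 1 else 0)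
    singleton with g n
    ... | true  = refl
    ... | false = refl

  count-last : ∀ {n k} → count g n ≡ suc k → ∃[ j ] j < n × g j ≡ true × count g j ≡ k
  count-last {suc n} {k} eq with g n in gn
  ... | true  = n , ≤-refl , gn , suc-injective (trans (+-comm 1 (count g n)) eq)
  ... | false with count-last (trans (sym (+-identityʳ (count g n))) eq)
  ...   | j , j<n , gj , count≡k = j , m≤n⇒m≤1+n j<n , gj , count≡k

  count-true : ∀ {j} → g j ≡ true → count g (suc j) ≡ suc (count g j)
  count-true {j} gj = trans (cong (λ z → count g j + (if z then 1 else 0)) gj) (+-comm (count g j) 1)

  count-false : ∀ {m n} → m ≤ n → (∀ {i} → m ≤ i → i < n → g i ≡ false) → count g n ≡ count g m
  count-false {m} {zero}  z≤n _ = refl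
  count-false {m} {suc n} m≤1+n none with m≤n⇒m<n∨m≡n m≤1+n
  ... | inj₂ refl = refl
  ... | inj₁ m<1+n = begin
    count g n + (if g n then 1 else 0) ≡⟨ cong (λ z → count g n + (if z then 1 else 0)) (none (≤-pred m<1+n) ≤-refl) ⟩
    count g n + 0                      ≡⟨ +-identityʳ _ ⟩
    count g n                          ≡⟨ count-false (≤-pred m<1+n) (λ m≤i i<n → none m≤i (m≤n⇒m≤1+n i<n)) ⟩
    count g m                          ∎
    where open ≡-Reasoning

  count-three : ∀ {x y z n} → x < y → y < z → z < n →
                g x ≡ true → g y ≡ true → g z ≡ true →
                (∀ {i} → i < n → i ≢ x → i ≢ y → i ≢ z → g i ≡ false) → count g n ≡ 3
  count-three {x} {y} {z} {n} x<y y<z z<n gx gy gz others = begin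
    count g n                   ≡⟨ count-false z<n (λ z<i i<n → others i<n (>⇒≢ (<-trans x<z z<i)) (>⇒≢ (<-trans y<z z<i)) (>⇒≢ z<i)) ⟩
    count g (suc z)             ≡⟨ count-true gz ⟩
    suc (count g z)             ≡⟨ cong suc (count-false y<z (λ y<i i<z → others (<-trans i<z z<n) (>⇒≢ (<-trans x<y y<i)) (>⇒≢ y<i) (<⇒≢ i<z))) ⟩
    suc (count g (suc y))       ≡⟨ cong suc (count-true gy) ⟩
    suc (suc (count g y))       ≡⟨ cong (suc ∘ suc) (count-false x<y (λ x<i i<y → others (<-trans i<y y<n) (>⇒≢ x<i) (<⇒≢ i<y) (<⇒≢ (<-trans i<y y<z)))) ⟩
    suc (suc (count g (suc x))) ≡⟨ cong (suc ∘ suc) (count-true gx) ⟩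
    suc (suc (suc (count g x))) ≡⟨ cong (suc ∘ suc ∘ suc) (count-false z≤n (λ _ i<x → others (<-trans i<x x<n) (<⇒≢ i<x) (<⇒≢ (<-trans i<x x<y)) (<⇒≢ (<-trans i<x x<z)))) ⟩
    3                           ∎
    where
    open ≡-Reasoning
    x<z = <-trans x<y y<z
    y<n = <-trans y<z z<n
    x<n = <-trans x<z z<n

module Base (a : ℕ) where

  b b-1 : ℕ
  b = suc (suc a)
  b-1 = suc a

  1<b : 1 < b
  1<b = s≤s (s≤s z≤n)

  /b-≤ : ∀ {v k} → v ≤ suc k → v / b ≤ k
  /b-≤ {zero}  _      = z≤n
  /b-≤ {suc w} {k} le = ≤-pred (≤-trans (m/n<m (suc w) b 1<b) le)

  sumOverQuotients : (ℕ → ℕ) → ℕ → ℕ → ℕ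
  sumOverQuotients h zero    v = 0
  sumOverQuotients h (suc k) v = h v + sumOverQuotients h k (v / b)

  module _ {h : ℕ → ℕ} (h0≡0 : h 0 ≡ 0) where

    sumOverQuotients-0 : ∀ k → sumOverQuotients h k 0 ≡ 0
    sumOverQuotients-0 zero    = refl
    sumOverQuotients-0 (suc k) = cong₂ _+_ h0≡0 (sumOverQuotients-0 k)

    sumOverQuotients-fuel : ∀ {k k′ v} → v ≤ k → v ≤ k′ →
                            sumOverQuotients h k v ≡ sumOverQuotients h k′ v
    sumOverQuotients-fuel {zero}  {k′}     z≤n _ = sym (sumOverQuotients-0 k′)
    sumOverQuotients-fuel {suc k} {zero}   _ z≤n = sumOverQuotients-0 (suc k)
    sumOverQuotients-fuel {suc k} {suc k′} {v} p q =
      cong (h v +_) (sumOverQuotients-fuel (/b-≤ p) (/b-≤ q))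

    sumOverQuotients-step : ∀ v → sumOverQuotients h v v ≡ h v + sumOverQuotients h (v / b) (v / b)
    sumOverQuotients-step zero    = sym (trans (+-identityʳ _) h0≡0)
    sumOverQuotients-step (suc w) = cong (h (suc w) +_) (sumOverQuotients-fuel {w} (/b-≤ {suc w} ≤-refl) ≤-refl)

  digitSumFuel≡sumOverQuotients : ∀ k v → digitSumFuel b k v ≡ sumOverQuotients (_% b) k v
  digitSumFuel≡sumOverQuotients zero    v = refl
  digitSumFuel≡sumOverQuotients (suc k) v = cong (v % b +_) (digitSumFuel≡sumOverQuotients k (v / b))

  s-step : ∀ v → s b v ≡ v % b + s b (v / b)
  s-step v = begin
    s b v                                          ≡⟨ digitSumFuel≡sumOverQuotients v v ⟩
    sumOverQuotients (_% b) v v                    ≡⟨ sumOverQuotients-step refl v ⟩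
    v % b + sumOverQuotients (_% b) (v / b) (v / b) ≡⟨ cong (v % b +_) (digitSumFuel≡sumOverQuotients (v / b) (v / b)) ⟨
    v % b + s b (v / b)                            ∎
    where open ≡-Reasoning

  -- quotientSum v = Σ_{i≥1} ⌊v / b^i⌋
  quotientSum : ℕ → ℕ
  quotientSum v = sumOverQuotients (_/ b) v v

  quotientSum-step : ∀ v → quotientSum v ≡ v / b + quotientSum (v / b)
  quotientSum-step = sumOverQuotients-step refl

  [q*b+z]/b≡q+z/b : ∀ q z → (q * b + z) / b ≡ q + z / b
  [q*b+z]/b≡q+z/b q z = begin
    (q * b + z) / b   ≡⟨ cong (_/ b) (+-comm (q * b) z) ⟩
    (z + q * b) / b   ≡⟨ +-distrib-/-∣ʳ z (divides q refl) ⟩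
    z / b + q * b / b ≡⟨ cong (z / b +_) (m*n/n≡m q b) ⟩
    z / b + q         ≡⟨ +-comm (z / b) q ⟩
    q + z / b         ∎
    where open ≡-Reasoning

  [x+y]/b≡x/b+[x%b+y]/b : ∀ x y → (x + y) / b ≡ x / b + (x % b + y) / b
  [x+y]/b≡x/b+[x%b+y]/b x y = begin
    (x + y) / b                    ≡⟨ cong (λ z → (z + y) / b) (m≡m%n+[m/n]*n x b) ⟩
    (x % b + x / b * b + y) / b    ≡⟨ cong (_/ b) (regroup (x % b) (x / b) y) ⟩
    (x / b * b + (x % b + y)) / b  ≡⟨ [q*b+z]/b≡q+z/b (x / b) (x % b + y) ⟩
    x / b + (x % b + y) / b        ∎
    where
    open ≡-Reasoning
    regroup : ∀ r q y → r + q * b + y ≡ q * b + (r + y)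
    regroup = solve-∀

  [q*b+r]/b≡q : ∀ q {r} → r < b → (q * b + r) / b ≡ q
  [q*b+r]/b≡q q {r} r<b = trans ([q*b+z]/b≡q+z/b q r) (trans (cong (q +_) (m<n⇒m/n≡0 r<b)) (+-identityʳ q))

  [q*b+r]%b≡r : ∀ q {r} → r < b → (q * b + r) % b ≡ r
  [q*b+r]%b≡r q {r} r<b = trans (cong (_% b) (+-comm (q * b) r)) (trans ([m+kn]%n≡m%n r q b) (m<n⇒m%n≡m r<b))

  s-digits : ∀ q {r} → r < b → s b (q * b + r) ≡ r + s b q
  s-digits q {r} r<b = trans (s-step (q * b + r)) (cong₂ _+_ ([q*b+r]%b≡r q r<b) (cong (s b) ([q*b+r]/b≡q q r<b)))

  s-digit : ∀ {r} → r < b → s b r ≡ r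
  s-digit r<b = trans (s-digits 0 r<b) (+-identityʳ _)

  s-pow : ∀ k → s b (b ^ k) ≡ 1
  s-pow zero    = s-digit 1<b
  s-pow (suc k) = begin
    s b (b * b ^ k)     ≡⟨ cong (s b) (trans (*-comm b (b ^ k)) (sym (+-identityʳ _))) ⟩
    s b (b ^ k * b + 0) ≡⟨ s-digits (b ^ k) (s≤s z≤n) ⟩
    s b (b ^ k)         ≡⟨ s-pow k ⟩
    1                   ∎
    where open ≡-Reasoning

  s-pow∸1 : ∀ k {w} → w + 1 ≡ b ^ k → s b w ≡ k * b-1
  s-pow∸1 zero    {w} e with +-cancelʳ-≡ 1 w 0 e
  ... | refl = refl
  s-pow∸1 (suc k) {w} e = begin
    s b w                ≡⟨ cong (s b) w≡ ⟩
    s b (w′ * b + b-1)   ≡⟨ s-digits w′ ≤-refl ⟩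
    b-1 + s b w′         ≡⟨ cong (b-1 +_) (s-pow∸1 k (m∸n+n≡m (m^n>0 b k))) ⟩
    b-1 + k * b-1        ∎
    where
    open ≡-Reasoning
    w′ = b ^ k ∸ 1
    split : ∀ w a → (2 + a) * (w + 1) ≡ (w * (2 + a) + (1 + a)) + 1
    split = solve-∀
    w≡ : w ≡ w′ * b + b-1
    w≡ = +-cancelʳ-≡ 1 _ _ (trans e (trans (cong (b *_) (sym (m∸n+n≡m (m^n>0 b k)))) (split w′ a)))

  s-+-quotientSum : ∀ v → s b v + b-1 * quotientSum v ≡ v
  s-+-quotientSum = <-rec _ step
    where
    step : ∀ v → (∀ {w} → w < v → s b w + b-1 * quotientSum w ≡ w) →
           s b v + b-1 * quotientSum v ≡ v
    step zero      _  = *-zeroʳ b-1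
    step v@(suc _) ih = begin
      s b v + b-1 * quotientSum v                  ≡⟨ cong₂ (λ x y → x + b-1 * y) (s-step v) (quotientSum-step v) ⟩
      v % b + s b q + b-1 * (q + quotientSum q)     ≡⟨ regroup (v % b) (s b q) q (quotientSum q) a ⟩
      v % b + (s b q + b-1 * quotientSum q) + b-1 * q ≡⟨ cong (λ x → v % b + x + b-1 * q) (ih (m/n<m v b 1<b)) ⟩
      v % b + q + b-1 * q                          ≡⟨ collect (v % b) q a ⟩
      v % b + q * b                                ≡⟨ m≡m%n+[m/n]*n v b ⟨
      v                                            ∎
      where
      open ≡-Reasoning
      q = v / b
      regroup : ∀ r S q t a → r + S + (1 + a) * (q + t) ≡ r + (S + (1 + a) * t) + (1 + a) * q
      regroup = solve-∀
      collect : ∀ r q a → r + q + (1 + a) * q ≡ r + q * (2 + a)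
      collect = solve-∀

  s≡0⇒≡0 : ∀ v → s b v ≡ 0 → v ≡ 0
  s≡0⇒≡0 = <-rec _ step
    where
    step : ∀ v → (∀ {w} → w < v → s b w ≡ 0 → w ≡ 0) → s b v ≡ 0 → v ≡ 0
    step zero      _  _   = refl
    step v@(suc _) ih s≡0 = begin
      v                 ≡⟨ m≡m%n+[m/n]*n v b ⟩
      v % b + v / b * b ≡⟨ cong₂ (λ x y → x + y * b) (m+n≡0⇒m≡0 (v % b) s≡0′) (ih (m/n<m v b 1<b) (m+n≡0⇒n≡0 (v % b) s≡0′)) ⟩
      0                 ∎
      where
      open ≡-Reasoning
      s≡0′ : v % b + s b (v / b) ≡ 0
      s≡0′ = trans (sym (s-step v)) s≡0

  s-pos : ∀ {v} → 0 < v → 0 < s b v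
  s-pos {v} 0<v with s b v in eq
  ... | suc _ = s≤s z≤n
  ... | zero with s≡0⇒≡0 v eq
  ...   | refl = 0<v

  carry : ∀ x y {γ} → γ ≤ 1 → ∃[ g ] g ≤ 1 × (x + y + γ) / b ≡ x / b + y / b + g
  carry x y {γ} γ≤1 = (rx + ry + γ) / b , g≤1 , eq
    where
    rx = x % b
    ry = y % b
    g≤1 : (rx + ry + γ) / b ≤ 1
    g≤1 = ≤-pred (m<n*o⇒m/o<n (begin-strict
      rx + ry + γ    ≤⟨ +-monoʳ-≤ (rx + ry) γ≤1 ⟩
      rx + ry + 1    ≡⟨ trans (+-assoc rx ry 1) (cong (rx +_) (+-comm ry 1)) ⟩
      rx + suc ry    <⟨ +-monoˡ-< (suc ry) (m%n<n x b) ⟩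
      b + suc ry     ≤⟨ +-monoʳ-≤ b (m%n<n y b) ⟩
      b + b          ≡⟨ cong (b +_) (+-identityʳ b) ⟨
      2 * b          ∎))
      where open ≤-Reasoning
    regroup : ∀ rx qx ry qy g b → (rx + qx * b) + (ry + qy * b) + g ≡ (qx + qy) * b + (rx + ry + g)
    regroup = solve-∀
    eq : (x + y + γ) / b ≡ x / b + y / b + (rx + ry + γ) / b
    eq = begin
      (x + y + γ) / b                                   ≡⟨ cong (λ z → z / b) (cong₂ (λ p q → p + q + γ) (m≡m%n+[m/n]*n x b) (m≡m%n+[m/n]*n y b)) ⟩
      (rx + x / b * b + (ry + y / b * b) + γ) / b        ≡⟨ cong (_/ b) (regroup rx (x / b) ry (y / b) γ b) ⟩
      ((x / b + y / b) * b + (rx + ry + γ)) / b          ≡⟨ [q*b+z]/b≡q+z/b (x / b + y / b) (rx + ry + γ) ⟩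
      x / b + y / b + (rx + ry + γ) / b                 ∎
      where open ≡-Reasoning

  quotientSum-digit : ∀ {z} → z < b → quotientSum z ≡ 0
  quotientSum-digit {z} z<b = trans (quotientSum-step z) (cong (λ q → q + quotientSum q) (m<n⇒m/n≡0 z<b))

  -- The excess of the left side over quotientSum x + quotientSum y counts the carries of the
  -- addition, at most one per digit except the leading one.
  quotientSum-+-≤ : ∀ n x y {γ} → γ ≤ 1 → x + y + γ < b ^ suc n →
                    quotientSum (x + y + γ) ≤ quotientSum x + quotientSum y + n
  quotientSum-+-≤ zero x y {γ} γ≤1 lt =
    ≤-trans (≤-reflexive (quotientSum-digit (subst (x + y + γ <_) (*-identityʳ b) lt))) z≤n
  quotientSum-+-≤ (suc n) x y {γ} γ≤1 lt with carry x y γ≤1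
  ... | g , g≤1 , eq = begin
    quotientSum z                                   ≡⟨ quotientSum-step z ⟩
    z / b + quotientSum (z / b)                     ≡⟨ cong (λ q → q + quotientSum q) eq ⟩
    z′ + quotientSum z′                             ≤⟨ +-monoʳ-≤ z′ (quotientSum-+-≤ n (x / b) (y / b) g≤1 lt′) ⟩
    z′ + (Qx + Qy + n)                              ≡⟨ regroup (x / b) (y / b) g Qx Qy n ⟩
    (x / b + Qx) + (y / b + Qy) + (g + n)           ≤⟨ +-monoʳ-≤ ((x / b + Qx) + (y / b + Qy)) (+-monoˡ-≤ n g≤1) ⟩
    (x / b + Qx) + (y / b + Qy) + suc n             ≡⟨ cong₂ (λ p q → p + q + suc n) (quotientSum-step x) (quotientSum-step y) ⟨
    quotientSum x + quotientSum y + suc n           ∎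
    where
    open ≤-Reasoning
    z = x + y + γ
    z′ = x / b + y / b + g
    Qx = quotientSum (x / b)
    Qy = quotientSum (y / b)
    regroup : ∀ p q g tp tq n → (p + q + g) + (tp + tq + n) ≡ (p + tp) + (q + tq) + (g + n)
    regroup = solve-∀
    lt′ : z′ < b ^ suc n
    lt′ = subst (_< b ^ suc n) eq (m<n*o⇒m/o<n (subst (z <_) (*-comm b (b ^ suc n)) lt))

  collision-gap : ∀ v d → f b v ≡ f b (v + d) →
                  ∃[ t ] quotientSum (v + d) ≡ quotientSum v + t × b-1 * t ≡ d + d
  collision-gap v d eq = t , sym (m+[n∸m]≡n X≤Y) , b-1*t≡d+d
    where
    X = quotientSum v
    Y = quotientSum (v + d)
    S = s b (v + d)
    sv≡d+S : s b v ≡ d + S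
    sv≡d+S = +-cancelˡ-≡ v _ _ (trans eq (+-assoc v d S))
    shuffle : ∀ S d X → d + S + X + d ≡ S + (d + d + X)
    shuffle = solve-∀
    b-1*Y : b-1 * Y ≡ d + d + b-1 * X
    b-1*Y = +-cancelˡ-≡ S _ _ (begin
      S + b-1 * Y               ≡⟨ s-+-quotientSum (v + d) ⟩
      v + d                     ≡⟨ cong (_+ d) (s-+-quotientSum v) ⟨
      s b v + b-1 * X + d       ≡⟨ cong (λ x → x + b-1 * X + d) sv≡d+S ⟩
      d + S + b-1 * X + d       ≡⟨ shuffle S d (b-1 * X) ⟩
      S + (d + d + b-1 * X)     ∎)
      where open ≡-Reasoning
    X≤Y : X ≤ Y
    X≤Y = *-cancelˡ-≤ b-1 (subst (b-1 * X ≤_) (sym b-1*Y) (m≤n+m (b-1 * X) (d + d)))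
    t = Y ∸ X
    b-1*t≡d+d : b-1 * t ≡ d + d
    b-1*t≡d+d = +-cancelʳ-≡ (b-1 * X) _ _ (begin
      b-1 * t + b-1 * X   ≡⟨ *-distribˡ-+ b-1 t X ⟨
      b-1 * (t + X)       ≡⟨ cong (b-1 *_) (trans (+-comm t X) (m+[n∸m]≡n X≤Y)) ⟩
      b-1 * Y             ≡⟨ b-1*Y ⟩
      d + d + b-1 * X     ∎)
      where open ≡-Reasoning

  -- Since b - 1 is odd, b - 1 ∣ 2 d forces b - 1 ∣ d.
  collision-offset : ¬ 2 ∣ b-1 → ∀ {v w} → v ≤ w → f b v ≡ f b w →
                     ∃[ m ] w ≡ v + b-1 * m × quotientSum w ≡ quotientSum v + (m + m)
  collision-offset b-1-odd {v} v≤w eq with m≤n⇒∃[o]m+o≡n v≤w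
  ... | d , refl with collision-gap v d eq
  ...   | t , Y≡X+t , b-1*t≡d+d
          with euclidsLemma b-1 t prime[2] (divides d (trans b-1*t≡d+d (n+n≡n*2 d)))
  ...     | inj₁ 2∣b-1          = contradiction 2∣b-1 b-1-odd
  ...     | inj₂ (divides m refl) = m , cong (v +_) d≡b-1*m , trans Y≡X+t (cong (quotientSum v +_) (sym (n+n≡n*2 m)))
    where
    d≡b-1*m : d ≡ b-1 * m
    d≡b-1*m = *-cancelʳ-≡ d (b-1 * m) 2 (begin
      d * 2          ≡⟨ n+n≡n*2 d ⟨
      d + d          ≡⟨ b-1*t≡d+d ⟨
      b-1 * (m * 2)  ≡⟨ *-assoc b-1 m 2 ⟨
      b-1 * m * 2    ∎)
      where open ≡-Reasoning

  offset-bound : ∀ n {v m} → 0 < m → quotientSum (v + b-1 * m) ≡ quotientSum v + (m + m) →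
                 v + b-1 * m < b ^ suc n → m < n
  offset-bound n {v} {m} 0<m T-eq lt = +-cancelˡ-< m m n (begin-strict
    m + m       ≤⟨ 2m≤ ⟩
    Td + n      <⟨ +-monoˡ-< n Td<m ⟩
    m + n       ∎)
    where
    open ≤-Reasoning
    d = b-1 * m
    Td = quotientSum d
    v+d≡v+d+0 : v + d ≡ v + d + 0
    v+d≡v+d+0 = sym (+-identityʳ (v + d))
    2m≤ : m + m ≤ Td + n
    2m≤ = +-cancelˡ-≤ (quotientSum v) _ _ (begin
      quotientSum v + (m + m)   ≡⟨ T-eq ⟨
      quotientSum (v + d)       ≡⟨ cong quotientSum v+d≡v+d+0 ⟩
      quotientSum (v + d + 0)   ≤⟨ quotientSum-+-≤ n v d z≤n (subst (_< b ^ suc n) v+d≡v+d+0 lt) ⟩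
      quotientSum v + Td + n    ≡⟨ +-assoc (quotientSum v) Td n ⟩
      quotientSum v + (Td + n)  ∎)
    Td<m : Td < m
    Td<m = *-cancelˡ-< b-1 Td m (begin-strict
      b-1 * Td            <⟨ m<n+m (b-1 * Td) (s-pos (≤-trans (s≤s z≤n) (*-monoʳ-≤ b-1 0<m))) ⟩
      s b d + b-1 * Td    ≡⟨ s-+-quotientSum d ⟩
      d                   ∎)

  module LastDigitCarry (v : ℕ) where

    carryOut : ℕ → ℕ
    carryOut m = (v % b + b-1 * m) / b

    v%b≤b-1 : v % b ≤ b-1
    v%b≤b-1 = ≤-pred (m%n<n v b)

    carryOut≤ : ∀ m → carryOut m ≤ m
    carryOut≤ m = ≤-pred (m<n*o⇒m/o<n (begin-strict
      v % b + b-1 * m       ≤⟨ +-monoˡ-≤ (b-1 * m) v%b≤b-1 ⟩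
      b-1 + b-1 * m         <⟨ m<m+n _ (s≤s z≤n) ⟩
      b-1 + b-1 * m + suc m ≡⟨ expand a m ⟩
      suc m * b             ∎))
      where
      open ≤-Reasoning
      expand : ∀ a m → (1 + a) + (1 + a) * m + (1 + m) ≡ (1 + m) * (2 + a)
      expand = solve-∀

    carryOut≤b : ∀ {m} → m ≤ suc b → carryOut m ≤ b
    carryOut≤b {m} m≤1+b = ≤-pred (m<n*o⇒m/o<n (begin-strict
      v % b + b-1 * m           ≤⟨ +-mono-≤ v%b≤b-1 (*-monoʳ-≤ b-1 m≤1+b) ⟩
      b-1 + b-1 * suc b         <⟨ m<m+n _ (s≤s z≤n) ⟩
      b-1 + b-1 * suc b + 2     ≡⟨ expand a ⟩
      suc b * b                 ∎))
      where
      open ≤-Reasoning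
      expand : ∀ a → (1 + a) + (1 + a) * (3 + a) + 2 ≡ (3 + a) * (2 + a)
      expand = solve-∀

    carryOut-+-≤ : ∀ m {k} → 0 < k → carryOut (m + k) ≤ carryOut m + k
    carryOut-+-≤ m {k} 0<k with carry (v % b + b-1 * m) (b-1 * k) {0} z≤n
    ... | g , g≤1 , eq = begin
      carryOut (m + k)      ≡⟨ cong (_/ b) (distrib (v % b) a m k) ⟩
      (x + y + 0) / b       ≡⟨ eq ⟩
      x / b + y / b + g     ≡⟨ +-assoc (x / b) (y / b) g ⟩
      x / b + (y / b + g)   ≤⟨ +-monoʳ-≤ (x / b) (≤-trans (+-monoʳ-≤ (y / b) g≤1) (subst (_≤ k) (+-comm 1 (y / b)) y/b<k)) ⟩
      carryOut m + k        ∎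
      where
      open ≤-Reasoning
      x = v % b + b-1 * m
      y = b-1 * k
      distrib : ∀ r a m k → r + (1 + a) * (m + k) ≡ r + (1 + a) * m + (1 + a) * k + 0
      distrib = solve-∀
      expand : ∀ a k → (1 + a) * k + k ≡ k * (2 + a)
      expand = solve-∀
      y/b<k : y / b < k
      y/b<k = m<n*o⇒m/o<n (subst (y <_) (expand a k) (m<m+n y 0<k))

    private
      p = v / b
      q = p / b

    secondCarry : ℕ → ℕ
    secondCarry m = (p % b + carryOut m) / b

    secondCarry≤1 : ∀ {m} → m ≤ suc b → secondCarry m ≤ 1
    secondCarry≤1 {m} m≤1+b = ≤-pred (m<n*o⇒m/o<n (subst (p % b + carryOut m <_) (cong (b +_) (sym (+-identityʳ b)))
                                                     (+-mono-<-≤ (m%n<n p b) (carryOut≤b m≤1+b))))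

    offset-balance : ∀ m → quotientSum (v + b-1 * m) ≡ quotientSum v + (m + m) →
                     carryOut m + secondCarry m + quotientSum (q + secondCarry m) ≡ quotientSum q + (m + m)
    offset-balance m T-eq = +-cancelˡ-≡ (p + q) _ _ (begin
      (p + q) + (δ + ε + quotientSum (q + ε))  ≡⟨ regroup₁ p q δ ε (quotientSum (q + ε)) ⟩
      (p + δ) + ((q + ε) + quotientSum (q + ε)) ≡⟨ T[v+d] ⟨
      quotientSum (v + b-1 * m)                ≡⟨ T-eq ⟩
      quotientSum v + (m + m)                  ≡⟨ cong (_+ (m + m)) (trans (quotientSum-step v) (cong (p +_) (quotientSum-step p))) ⟩
      p + (q + quotientSum q) + (m + m)        ≡⟨ regroup₂ p q (quotientSum q) (m + m) ⟩
      (p + q) + (quotientSum q + (m + m))      ∎)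
      where
      open ≡-Reasoning
      δ = carryOut m
      ε = secondCarry m
      T[v+d] : quotientSum (v + b-1 * m) ≡ (p + δ) + ((q + ε) + quotientSum (q + ε))
      T[v+d] = begin
        quotientSum (v + b-1 * m)                          ≡⟨ quotientSum-step (v + b-1 * m) ⟩
        (v + b-1 * m) / b + quotientSum ((v + b-1 * m) / b) ≡⟨ cong (λ z → z + quotientSum z) ([x+y]/b≡x/b+[x%b+y]/b v (b-1 * m)) ⟩
        (p + δ) + quotientSum (p + δ)                      ≡⟨ cong (p + δ +_) (quotientSum-step (p + δ)) ⟩
        (p + δ) + ((p + δ) / b + quotientSum ((p + δ) / b)) ≡⟨ cong (λ z → p + δ + (z + quotientSum z)) ([x+y]/b≡x/b+[x%b+y]/b p δ) ⟩
        (p + δ) + ((q + ε) + quotientSum (q + ε))          ∎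
      regroup₁ : ∀ p q δ e t → (p + q) + (δ + e + t) ≡ (p + δ) + ((q + e) + t)
      regroup₁ = solve-∀
      regroup₂ : ∀ p q t n → p + (q + t) + n ≡ (p + q) + (t + n)
      regroup₂ = solve-∀

    -- For m ≤ b + 1 the carry out of the second digit is at most 1, and a zero carry would
    -- force carryOut m = 2m > m.
    offset-carry : ∀ {m} → 0 < m → m ≤ suc b →
                   quotientSum (v + b-1 * m) ≡ quotientSum v + (m + m) →
                   carryOut m + 1 + quotientSum (q + 1) ≡ quotientSum q + (m + m)
    offset-carry {m} 0<m m≤1+b T-eq = subst Balanced ε≡1 (offset-balance m T-eq)
      where
      δ = carryOut m
      ε = secondCarry m
      Balanced : ℕ → Set
      Balanced e = δ + e + quotientSum (q + e) ≡ quotientSum q + (m + m)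
      ε≢0 : ε ≢ 0
      ε≢0 ε≡0 = <⇒≱ (m<m+n m 0<m) (subst (_≤ m) δ≡2m (carryOut≤ m))
        where
        open ≡-Reasoning
        δ≡2m : δ ≡ m + m
        δ≡2m = +-cancelʳ-≡ (quotientSum q) _ _ (begin
          δ + quotientSum q              ≡⟨ cong₂ (λ x y → x + quotientSum y) (+-identityʳ δ) (+-identityʳ q) ⟨
          δ + 0 + quotientSum (q + 0)    ≡⟨ subst Balanced ε≡0 (offset-balance m T-eq) ⟩
          quotientSum q + (m + m)        ≡⟨ +-comm (quotientSum q) (m + m) ⟩
          m + m + quotientSum q          ∎)
      ε≡1 : ε ≡ 1
      ε≡1 = ≤-antisym (secondCarry≤1 m≤1+b) (n≢0⇒n>0 ε≢0)

    -- carryOut grows by at most k from m to m + k, while offset-carry demands growth 2k.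
    offset-unique : ∀ {m m′} → 0 < m → m < m′ → m′ ≤ suc b →
                    quotientSum (v + b-1 * m) ≡ quotientSum v + (m + m) →
                    quotientSum (v + b-1 * m′) ≡ quotientSum v + (m′ + m′) → ⊥
    offset-unique {m} 0<m m<m′ m′≤1+b T-eq T-eq′ with m≤n⇒∃[o]m+o≡n (<⇒≤ m<m′)
    ... | zero  , refl = <-irrefl (sym (+-identityʳ m)) m<m′
    ... | k@(suc _) , refl = <⇒≱ (m<m+n (X + k) (s≤s z≤n)) (begin
      X + k + k                     ≡⟨ regroup₁ (quotientSum q) m k ⟩
      quotientSum q + ((m + k) + (m + k)) ≡⟨ offset-carry (≤-trans 0<m (m≤m+n m k)) m′≤1+b T-eq′ ⟨
      carryOut (m + k) + 1 + R      ≤⟨ +-monoˡ-≤ R (+-monoˡ-≤ 1 (carryOut-+-≤ m (s≤s z≤n))) ⟩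
      carryOut m + k + 1 + R        ≡⟨ regroup₂ (carryOut m) k R ⟩
      carryOut m + 1 + R + k        ≡⟨ cong (_+ k) (offset-carry 0<m (≤-trans (m≤m+n m k) m′≤1+b) T-eq) ⟩
      X + k                         ∎)
      where
      open ≤-Reasoning
      R = quotientSum (q + 1)
      X = quotientSum q + (m + m)
      regroup₁ : ∀ t m k → t + (m + m) + k + k ≡ t + ((m + k) + (m + k))
      regroup₁ = solve-∀
      regroup₂ : ∀ x k r → x + k + 1 + r ≡ x + 1 + r + k
      regroup₂ = solve-∀

  NoTripleCollision : ℕ → Set
  NoTripleCollision n = ∀ {v₁ v₂ v₃} → v₁ < v₂ → v₂ < v₃ → v₃ < n →
                        f b v₁ ≡ f b v₂ → f b v₁ ≡ f b v₃ → ⊥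

  offset-pos : ∀ {v m} → v < v + b-1 * m → 0 < m
  offset-pos {v} {zero}  lt = contradiction (subst (v <_) (trans (cong (v +_) (*-zeroʳ b-1)) (+-identityʳ v)) lt) (n≮n v)
  offset-pos {m = suc _} _  = s≤s z≤n

  noTripleCollision-odd : ¬ 2 ∣ b-1 → NoTripleCollision (b ^ (b + 3))
  noTripleCollision-odd b-1-odd {v₁} v₁<v₂ v₂<v₃ v₃<n e₂ e₃
    with collision-offset b-1-odd (<⇒≤ v₁<v₂) e₂ | collision-offset b-1-odd (<⇒≤ (<-trans v₁<v₂ v₂<v₃)) e₃
  ... | m , refl , T-eq | m′ , refl , T-eq′ =
    LastDigitCarry.offset-unique v₁ (offset-pos {v₁} v₁<v₂) m<m′ (≤-pred m′<2+b) T-eq T-eq′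
    where
    m<m′ : m < m′
    m<m′ = *-cancelˡ-< b-1 m m′ (+-cancelˡ-< v₁ _ _ v₂<v₃)
    m′<2+b : m′ < suc (suc b)
    m′<2+b = offset-bound (suc (suc b)) {v₁} (offset-pos {v₁} (<-trans v₁<v₂ v₂<v₃)) T-eq′
               (subst (_<_ (v₁ + b-1 * m′)) (cong (b ^_) (+-comm b 3)) v₃<n)

  f-twoDigits : ∀ {v} → v < b * b → f b v ≡ v / b * suc b + (v % b + v % b)
  f-twoDigits {v} v<b² = begin
    v + s b v                      ≡⟨ cong₂ _+_ (m≡m%n+[m/n]*n v b) (s-step v) ⟩
    (y + x * b) + (y + s b x)      ≡⟨ cong (λ z → (y + x * b) + (y + z)) (s-digit (m<n*o⇒m/o<n v<b²)) ⟩
    (y + x * b) + (y + x)          ≡⟨ regroup y x a ⟩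
    x * suc b + (y + y)            ∎
    where
    open ≡-Reasoning
    x = v / b
    y = v % b
    regroup : ∀ y x a → (y + x * (2 + a)) + (y + x) ≡ x * (3 + a) + (y + y)
    regroup = solve-∀

  collision-twoDigits-/b : ∀ {u w} → u < w → w < b * b → f b u ≡ f b w → u / b < w / b
  collision-twoDigits-/b {u} {w} u<w w<b² eq = ≤∧≢⇒< (/-monoˡ-≤ b (<⇒≤ u<w)) u/b≢w/b
    where
    u/b≢w/b : u / b ≢ w / b
    u/b≢w/b u/b≡w/b = <⇒≢ u<w (begin
      u                  ≡⟨ m≡m%n+[m/n]*n u b ⟩
      u % b + u / b * b  ≡⟨ cong₂ (λ p q → p + q * b) u%b≡w%b u/b≡w/b ⟩
      w % b + w / b * b  ≡⟨ m≡m%n+[m/n]*n w b ⟨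
      w                  ∎)
      where
      open ≡-Reasoning
      u%b≡w%b : u % b ≡ w % b
      u%b≡w%b = m+m≡n+n⇒m≡n (+-cancelˡ-≡ (w / b * suc b) _ _ (begin
        w / b * suc b + (u % b + u % b) ≡⟨ cong (λ z → z * suc b + (u % b + u % b)) u/b≡w/b ⟨
        u / b * suc b + (u % b + u % b) ≡⟨ f-twoDigits (<-trans u<w w<b²) ⟨
        f b u                           ≡⟨ eq ⟩
        f b w                           ≡⟨ f-twoDigits w<b² ⟩
        w / b * suc b + (w % b + w % b) ∎))

  -- Three collisions would need leading digits x₁ + 2 ≤ x₃, i.e. a last-digit gap of b + 1.
  noTripleCollision-b² : NoTripleCollision (b ^ 2)
  noTripleCollision-b² {v₁} {v₂} {v₃} v₁<v₂ v₂<v₃ v₃<b^2 e₂ e₃ = <-irrefl refl (begin-strict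
    x₁ * suc b + (y₁ + y₁)       <⟨ +-monoʳ-< (x₁ * suc b) (+-mono-< (m%n<n v₁ b) (m%n<n v₁ b)) ⟩
    x₁ * suc b + (b + b)         ≤⟨ m≤m+n _ 2 ⟩
    x₁ * suc b + (b + b) + 2     ≡⟨ expand x₁ a ⟩
    (2 + x₁) * suc b             ≤⟨ *-monoˡ-≤ (suc b) x₁+2≤x₃ ⟩
    x₃ * suc b                   ≤⟨ m≤m+n _ _ ⟩
    x₃ * suc b + (y₃ + y₃)       ≡⟨ f-twoDigits v₃<b² ⟨
    f b v₃                       ≡⟨ trans (sym e₃) (f-twoDigits (<-trans v₁<v₂ (<-trans v₂<v₃ v₃<b²))) ⟩
    x₁ * suc b + (y₁ + y₁)       ∎)
    where
    open ≤-Reasoning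
    v₃<b² = subst (v₃ <_) (cong (b *_) (*-identityʳ b)) v₃<b^2
    x₁ = v₁ / b
    x₃ = v₃ / b
    y₁ = v₁ % b
    y₃ = v₃ % b
    x₁+2≤x₃ : 2 + x₁ ≤ x₃
    x₁+2≤x₃ = ≤-trans (s≤s (collision-twoDigits-/b v₁<v₂ (<-trans v₂<v₃ v₃<b²) e₂))
                     (collision-twoDigits-/b v₂<v₃ v₃<b² (trans (sym e₂) e₃))
    expand : ∀ x a → x * (3 + a) + ((2 + a) + (2 + a)) + 2 ≡ (2 + x) * (3 + a)
    expand = solve-∀

  isPreimage : ℕ → ℕ → Bool
  isPreimage u v = does (f b v ≟ u)

  isPreimage-sound : ∀ u v → isPreimage u v ≡ true → f b v ≡ u
  isPreimage-sound u v eq = ≡ᵇ⇒≡ (f b v) u (subst T (sym eq) _)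

  F≡count : ∀ u → F b u ≡ count (isPreimage u) (suc u)
  F≡count u = length-filter-upTo (isPreimage u) (suc u)

  -- The largest preimage of u < 1 + n is below n, because n itself maps to 1 + n.
  F≢3 : ∀ {n} → NoTripleCollision n → f b n ≡ suc n → ∀ {u} → u < suc n → F b u ≢ 3
  F≢3 {n} none fn {u} u<1+n F≡3
    with count-last (isPreimage u) {suc u} (trans (sym (F≡count u)) F≡3)
  ... | v₃ , v₃<1+u , g₃ , c₃ with count-last (isPreimage u) {v₃} c₃
  ... | v₂ , v₂<v₃ , g₂ , c₂ with count-last (isPreimage u) {v₂} c₂
  ... | v₁ , v₁<v₂ , g₁ , _ = none v₁<v₂ v₂<v₃ v₃<n (trans f₁ (sym f₂)) (trans f₁ (sym f₃))
    where
    f₁ = isPreimage-sound u v₁ g₁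
    f₂ = isPreimage-sound u v₂ g₂
    f₃ = isPreimage-sound u v₃ g₃
    v₃<n : v₃ < n
    v₃<n with m≤n⇒m<n∨m≡n (≤-trans (≤-pred v₃<1+u) (≤-pred u<1+n))
    ... | inj₁ v₃<n = v₃<n
    ... | inj₂ refl = ⊥-elim (<⇒≱ u<1+n (≤-reflexive (trans (sym fn) f₃)))

  F[1+n]≡3 : ∀ {n v w} → NoTripleCollision n → f b n ≡ suc n → v < w → w < n →
             f b v ≡ suc n → f b w ≡ suc n → F b (suc n) ≡ 3
  F[1+n]≡3 {n} {v} {w} none fn v<w w<n fv fw = trans (F≡count (suc n))
    (count-three (isPreimage (suc n)) v<w w<n (m<n⇒m<1+n (n<1+n n))
      (dec-true (f b v ≟ suc n) fv) (dec-true (f b w ≟ suc n) fw) (dec-true (f b n ≟ suc n) fn)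
      (λ {i} i<2+n i≢v i≢w i≢n → dec-false (f b i ≟ suc n) (noOtherPreimage i<2+n i≢v i≢w i≢n)))
    where
    noOtherPreimage : ∀ {i} → i < suc (suc n) → i ≢ v → i ≢ w → i ≢ n → f b i ≢ suc n
    noOtherPreimage {i} i<2+n i≢v i≢w i≢n fi with m≤n⇒m<n∨m≡n (≤-pred i<2+n)
    ... | inj₂ refl = <-irrefl (sym fi) (m<m+n (suc n) (s-pos {suc n} (s≤s z≤n)))
    ... | inj₁ i<1+n with m≤n⇒m<n∨m≡n (≤-pred i<1+n)
    ...   | inj₂ i≡n = i≢n i≡n
    ...   | inj₁ i<n with <-cmp i v | <-cmp i w
    ...     | tri< i<v _ _ | _            = none i<v v<w w<n (trans fi (sym fv)) (trans fi (sym fw))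
    ...     | tri≈ _ i≡v _ | _            = i≢v i≡v
    ...     | tri> _ _ v<i | tri< i<w _ _ = none v<i i<w w<n (trans fv (sym fi)) (trans fv (sym fw))
    ...     | tri> _ _ _   | tri≈ _ i≡w _ = i≢w i≡w
    ...     | tri> _ _ _   | tri> _ _ w<i = none v<w w<i i<n (trans fv (sym fw)) (trans fv (sym fi))

  f-pow : ∀ k → f b (b ^ k) ≡ suc (b ^ k)
  f-pow k = trans (cong (b ^ k +_) (s-pow k)) (+-comm (b ^ k) 1)

  CollidingPairBelow : ℕ → Set
  CollidingPairBelow n = ∃[ v ] ∃[ v′ ] v < v′ × v′ < n × f b v ≡ suc n × f b v′ ≡ suc n

  IsK-pow+1 : ∀ k → NoTripleCollision (b ^ k) → CollidingPairBelow (b ^ k) → IsK b 3 (b ^ k + 1)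
  IsK-pow+1 k none (v , v′ , v<v′ , v′<n , fv , fv′) = subst (IsK b 3) (+-comm 1 (b ^ k))
    (F[1+n]≡3 none (f-pow k) v<v′ v′<n fv fv′ , λ u → F≢3 none (f-pow k) {u})

  isFloorLog-pow+1 : ∀ k → IsFloorLog b (b ^ suc k + 1) (suc k)
  isFloorLog-pow+1 k = m≤m+n (b ^ suc k) 1 , (begin-strict
    x + 1           <⟨ m<m+n (x + 1) (s≤s z≤n) ⟩
    x + 1 + 1       ≡⟨ +-assoc x 1 1 ⟩
    x + 2           ≤⟨ +-monoʳ-≤ x (≤-trans 2≤x (m≤m+n x (a * x))) ⟩
    x + (x + a * x) ∎)
    where
    open ≤-Reasoning
    x = b ^ suc k
    2≤x : 2 ≤ x
    2≤x = ≤-trans (s≤s (s≤s z≤n)) (subst (_≤ x) (*-identityʳ b) (*-monoʳ-≤ b (m^n>0 b k)))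

  -- Writing w for the number with b digits b - 1, the numbers with digits
  -- (w, b - 2, b - 1, 2) and (w, b - 1, 0, 1) both map to b^(b+3) + 1.
  collidingPair-b^[b+3] : 1 ≤ a → CollidingPairBelow (b ^ (b + 3))
  collidingPair-b^[b+3] 1≤a = v , v′ , v<v′ , v′<N , fv , fv′
    where
    N = b ^ (b + 3)
    w = b ^ b ∸ 1
    w+1≡b^b : w + 1 ≡ b ^ b
    w+1≡b^b = m∸n+n≡m (m^n>0 b b)
    N≡ : N ≡ (w + 1) * (b * (b * (b * 1)))
    N≡ = trans (^-distribˡ-+-* b b 3) (cong (_* (b * (b * (b * 1)))) (sym w+1≡b^b))
    sw : s b w ≡ b * b-1
    sw = s-pow∸1 b w+1≡b^b
    v  = ((w * b + a) * b + b-1) * b + 2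
    v′ = ((w * b + b-1) * b + 0) * b + 1
    sv : s b v ≡ 2 + (b-1 + (a + b * b-1))
    sv = trans (s-digits ((w * b + a) * b + b-1) (s≤s (s≤s 1≤a)))
           (cong (2 +_) (trans (s-digits (w * b + a) ≤-refl)
             (cong (b-1 +_) (trans (s-digits w (m≤n⇒m≤1+n ≤-refl)) (cong (a +_) sw)))))
    sv′ : s b v′ ≡ 1 + (0 + (b-1 + b * b-1))
    sv′ = trans (s-digits ((w * b + b-1) * b + 0) 1<b)
            (cong (1 +_) (trans (s-digits (w * b + b-1) (s≤s z≤n))
              (cong (0 +_) (trans (s-digits w ≤-refl) (cong (b-1 +_) sw)))))
    f-v : ∀ w a → ((w * (2 + a) + a) * (2 + a) + (1 + a)) * (2 + a) + 2 + (2 + ((1 + a) + (a + (2 + a) * (1 + a))))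
                  ≡ suc ((w + 1) * ((2 + a) * ((2 + a) * ((2 + a) * 1))))
    f-v = solve-∀
    f-v′ : ∀ w a → ((w * (2 + a) + (1 + a)) * (2 + a) + 0) * (2 + a) + 1 + (1 + (0 + ((1 + a) + (2 + a) * (1 + a))))
                   ≡ suc ((w + 1) * ((2 + a) * ((2 + a) * ((2 + a) * 1))))
    f-v′ = solve-∀
    fv : f b v ≡ suc N
    fv = trans (cong (v +_) sv) (trans (f-v w a) (cong suc (sym N≡)))
    fv′ : f b v′ ≡ suc N
    fv′ = trans (cong (v′ +_) sv′) (trans (f-v′ w a) (cong suc (sym N≡)))
    gap : ∀ w a → suc (((w * (2 + a) + a) * (2 + a) + (1 + a)) * (2 + a) + 2) + a
                  ≡ ((w * (2 + a) + (1 + a)) * (2 + a) + 0) * (2 + a) + 1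
    gap = solve-∀
    gap′ : ∀ w a → suc (((w * (2 + a) + (1 + a)) * (2 + a) + 0) * (2 + a) + 1) + (a * a + 4 * a + 2)
                   ≡ (w + 1) * ((2 + a) * ((2 + a) * ((2 + a) * 1)))
    gap′ = solve-∀
    v<v′ : v < v′
    v<v′ = subst (suc v ≤_) (gap w a) (m≤m+n _ _)
    v′<N : v′ < N
    v′<N = subst (suc v′ ≤_) (trans (gap′ w a) (sym N≡)) (m≤m+n _ _)

-- For b = 2c + 5 the numbers with digits (b - 2, c + 4) and (b - 1, 1) both map to b² + 1.
collidingPair-b² : ∀ c → let open Base (c + c + 3) in CollidingPairBelow (b ^ 2)
collidingPair-b² c = v , v′ , v<v′ , v′<b² , fv , fv′
  where
  open Base (c + c + 3)
  b-2 = c + c + 3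
  c+4<b : c + 4 < b
  c+4<b = subst (suc (c + 4) ≤_) (shift c) (m≤m+n _ c)
    where
    shift : ∀ c → suc (c + 4) + c ≡ 2 + (c + c + 3)
    shift = solve-∀
  v  = b-2 * b + (c + 4)
  v′ = b-1 * b + 1
  f-v : ∀ c → (c + c + 3) * (2 + (c + c + 3)) + (c + 4) + ((c + 4) + (c + c + 3)) ≡ suc ((2 + (c + c + 3)) * ((2 + (c + c + 3)) * 1))
  f-v = solve-∀
  f-v′ : ∀ a → (1 + a) * (2 + a) + 1 + (1 + (1 + a)) ≡ suc ((2 + a) * ((2 + a) * 1))
  f-v′ = solve-∀
  fv : f b v ≡ suc (b ^ 2)
  fv = trans (cong (v +_) (trans (s-digits b-2 c+4<b) (cong ((c + 4) +_) (s-digit (m≤n⇒m≤1+n ≤-refl))))) (f-v c)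
  fv′ : f b v′ ≡ suc (b ^ 2)
  fv′ = trans (cong (v′ +_) (trans (s-digits b-1 1<b) (cong (1 +_) (s-digit ≤-refl)))) (f-v′ b-2)
  v<v′ : v < v′
  v<v′ = begin-strict
    b-2 * b + (c + 4)  <⟨ +-monoʳ-< (b-2 * b) c+4<b ⟩
    b-2 * b + b        ≡⟨ +-comm (b-2 * b) b ⟩
    b-1 * b            <⟨ m<m+n (b-1 * b) (s≤s z≤n) ⟩
    b-1 * b + 1        ∎
    where open ≤-Reasoning
  v′<b² : v′ < b ^ 2
  v′<b² = begin-strict
    b-1 * b + 1        <⟨ +-monoʳ-< (b-1 * b) 1<b ⟩
    b-1 * b + b        ≡⟨ +-comm (b-1 * b) b ⟩
    b * b              ≡⟨ cong (b *_) (*-identityʳ b) ⟨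
    b ^ 2              ∎
    where open ≤-Reasoning

case-b≡2 : (b : ℕ) .{{_ : NonZero b}} → b ≡ 2 → IsK b 3 129 × IsFloorLog b 129 7
case-b≡2 .2 refl = (refl , λ u → toWitness {a? = allUpTo? (λ u → ¬? (F 2 u ≟ 3)) 129} _ {u}) , Base.isFloorLog-pow+1 0 6

case-b≡3 : (b : ℕ) .{{_ : NonZero b}} → b ≡ 3 → IsK b 3 28 × IsFloorLog b 28 3
case-b≡3 .3 refl = (refl , λ u → toWitness {a? = allUpTo? (λ u → ¬? (F 3 u ≟ 3)) 28} _ {u}) , Base.isFloorLog-pow+1 1 2

case-even : ∀ a → let b = suc (suc a) in b ≥ 4 → 2 ∣ b →
            IsK b 3 (b ^ (b + 3) + 1) × IsFloorLog b (b ^ (b + 3) + 1) (b + 3)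
case-even a (s≤s (s≤s 2≤a)) 2∣b =
  IsK-pow+1 (b + 3) (noTripleCollision-odd (2∣1+n⇒¬2∣n 2∣b)) (collidingPair-b^[b+3] (≤-trans (s≤s z≤n) 2≤a)) ,
  subst (λ k → IsFloorLog b (b ^ k + 1) k) (sym (+-suc b 2)) (isFloorLog-pow+1 (b + 2))
  where open Base a

case-odd : ∀ a → let b = suc (suc a) in b ≥ 5 → ¬ 2 ∣ b →
          IsK b 3 (b ^ 2 + 1) × IsFloorLog b (b ^ 2 + 1) 2
case-odd a 5≤b ¬2∣b with ¬2∣⇒odd (suc (suc a)) ¬2∣b
... | suc zero    , refl = contradiction 5≤b λ { (s≤s (s≤s (s≤s ()))) }
... | suc (suc c) , refl = subst (λ a → let b = suc (suc a) in IsK b 3 (b ^ 2 + 1) × IsFloorLog b (b ^ 2 + 1) 2) (shift c)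
                             (IsK-pow+1 2 noTripleCollision-b² (collidingPair-b² c) , isFloorLog-pow+1 1)
  where
  open Base (c + c + 3)
  shift : ∀ c → c + c + 3 ≡ suc (c + suc (suc c))
  shift = solve-∀

theorem4p3 : (b : ℕ) .{{_ : NonZero b}} → b ≥ 2 →
    (b ≡ 2 → IsK b 3 129 × IsFloorLog b 129 7)
    × (b ≡ 3 → IsK b 3 28 × IsFloorLog b 28 3)
    × (b ≥ 4 → 2 ∣ b → IsK b 3 (b ^ (b + 3) + 1) × IsFloorLog b (b ^ (b + 3) + 1) (b + 3))
    × (b ≥ 5 → ¬ (2 ∣ b) → IsK b 3 (b ^ 2 + 1) × IsFloorLog b (b ^ 2 + 1) 2)
theorem4p3 b@(suc (suc a)) (s≤s (s≤s z≤n)) = case-b≡2 b , case-b≡3 b , case-even a , case-odd a
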